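{- Let $A$ be a poset with top $\top$ and bottom $\bot$, let $n\ge1$, and let $G_1,\ldots,G_n$ be games over $A$ realizable with sizes $p_1,\ldots,p_n$, respectively. Then $\{G_1,\ldots,G_n\mid\bot\}$ is realizable with size $\max\{p_1,\ldots,p_n\}+2\lceil\log_2 n\rceil+1$.
   Context: Games over $A$: atomic $[x]$ ($x\in A$) with no options, or composite $\{L\mid R\}$ with non-empty sets of left and right options; inside braces an atom $x$ stands for $[x]$. $\le$ and $\lhd$ by mutual recursion: $G\le H$ iff every left option $G^L$ satisfies $G^L\lhd H$, every right option $H^R$ satisfies $G\lhd H^R$, and if $G$ or $H$ is atomic then $G\lhd H$; $G\lhd H$ iff some $G^R\le H$, or $G\le$ some $H^L$, or $G=[x],H=[y]$ with $x\le y$; $G\equiv H$ iff $G\le H$ and $H\le G$. A monotone set coloring game $S$ over $A$ is a pair $(|S|,\phi_S)$ with $|S|$ a finite set of cells and $\phi_S:\{\bot,\top\}^{|S|}\to A$ monotone (pointwise order). Positions are maps $p:|S|\to\{\top,\bot,\star\}$, atomic if no $\star$. $[\![p]\!]=[\phi_S(p)]$ if $p$ is atomic, else $\{[\![p^L]\!]\mid[\![p^R]\!]\}$ where $p^L$ (resp. $p^R$) ranges over positions obtained by changing one $\star$-cell to $\top$ (resp. $\bot$); $[\![S]\!]$ is $[\![\cdot]\!]$ of the all-$\star$ position. The size of $S$ is the cardinality of $|S|$. $G$ is realizable with size $p$ if $G\equiv[\![S]\!]$ for some monotone set coloring game $S$ over $A$ of size $p$. -}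

module Defs where

open import Level using (Level; _⊔_)
open import Data.Nat as ℕ using (ℕ; zero; suc; NonZero)
open import Data.Fin as Fin using (Fin)
open import Data.Bool as Bool using (Bool; true; false; if_then_else_)
open import Data.Maybe using (Maybe; just; nothing; is-nothing; fromMaybe)
open import Data.List as List using (List; []; _∷_)
open import Data.List.NonEmpty as List⁺ using (List⁺; _∷_; toList)
open import Data.List.Membership.Propositional using (_∈_)
open import Data.Product using (Σ; _×_; _,_)
open import Data.Sum using (_⊎_)
open import Data.Unit.Polymorphic using (⊤)
open import Data.Empty.Polymorphic using (⊥)
open import Relation.Nullary.Decidable using (⌊_⌋)
open import Relation.Binary.Bundles using (Poset)

data Game {a} (A : Set a) : Set a where
  atom : A → Game A
  node : List⁺ (Game A) → List⁺ (Game A) → Game A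

module _ {a} {A : Set a} where

  lefts : Game A → List (Game A)
  lefts (atom _)   = []
  lefts (node L _) = toList L

  rights : Game A → List (Game A)
  rights (atom _)   = []
  rights (node _ R) = toList R

  IsAtomic : Game A → Set a
  IsAtomic (atom _)   = ⊤
  IsAtomic (node _ _) = ⊥

module GameOrder {c ℓ₁ ℓ₂} (P : Poset c ℓ₁ ℓ₂) where
  open Poset P renaming (Carrier to A; _≤_ to _≤A_)

  data _≤G_ : Game A → Game A → Set (c ⊔ ℓ₂)
  data _◁_  : Game A → Game A → Set (c ⊔ ℓ₂)

  data _≤G_ where
    ≤G-intro : ∀ {G H} →
      (∀ {GL} → GL ∈ lefts G → GL ◁ H) →
      (∀ {HR} → HR ∈ rights H → G ◁ HR) →
      (IsAtomic G ⊎ IsAtomic H → G ◁ H) →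
      G ≤G H

  data _◁_ where
    ◁-right : ∀ {G H GR} → GR ∈ rights G → GR ≤G H → G ◁ H
    ◁-left  : ∀ {G H HL} → HL ∈ lefts H → G ≤G HL → G ◁ H
    ◁-atom  : ∀ {x y} → x ≤A y → atom x ◁ atom y

  _≡G_ : Game A → Game A → Set (c ⊔ ℓ₂)
  G ≡G H = G ≤G H × H ≤G G

  -- Monotone set coloring games with cell set Fin p.
  -- Colors: true = ⊤, false = ⊥ (Bool ordered false ≤ true).

  record MSCG (p : ℕ) : Set (c ⊔ ℓ₂) where
    field
      φ    : (Fin p → Bool) → A
      mono : ∀ u v → (∀ i → u i Bool.≤ v i) → φ u ≤A φ v

  -- Positions: just b = cell colored b (true = ⊤, false = ⊥), nothing = ⋆.
  Position : ℕ → Set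
  Position p = Fin p → Maybe Bool

  module _ {p : ℕ} (S : MSCG p) where
    open MSCG S

    stars : Position p → List (Fin p)
    stars q = List.filter (λ i → Bool.T? (is-nothing (q i))) (List.allFin p)

    setCell : Position p → Fin p → Bool → Position p
    setCell q i b j = if ⌊ j Fin.≟ i ⌋ then just b else q j

    -- value of an atomic position (the default is never used on atomic ones)
    colour : Position p → Fin p → Bool
    colour q i = fromMaybe false (q i)

    -- ⟦ q ⟧ computed with fuel k; correct whenever k ≥ number of ⋆-cells
    -- (each move removes exactly one ⋆), in particular for the start.
    eval : ℕ → Position p → Game A
    eval zero    q = atom (φ (colour q))
    eval (suc k) q with stars q
    ... | []     = atom (φ (colour q))
    ... | i ∷ is = node (List⁺.map (λ j → eval k (setCell q j true))  (i ∷ is))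
                        (List⁺.map (λ j → eval k (setCell q j false)) (i ∷ is))

    ⟦_⟧ : Game A
    ⟦_⟧ = eval p (λ _ → nothing)

  Realizable : Game A → ℕ → Set (c ⊔ ℓ₂)
  Realizable G p = Σ (MSCG p) λ S → G ≡G ⟦ S ⟧

fromFin⁺ : ∀ {a} {X : Set a} (n : ℕ) .{{_ : NonZero n}} → (Fin n → X) → List⁺ X
fromFin⁺ (suc n) f = f Fin.zero ∷ List.tabulate (λ i → f (Fin.suc i))

maxFin : (n : ℕ) → (Fin n → ℕ) → ℕ
maxFin n f = List.foldr ℕ._⊔_ 0 (List.tabulate f)

-- The realizing game has m + 2k + 1 cells: the m cells shared by the realizations of the Gᵢ, k pairs
-- of selector cells and a gate. Its colouring reads the pairs in order: the first pair coloured (⊤,⊤)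
-- or (⊥,⊥) fixes the value ⊤ or ⊥; if every pair is split, the first cells of the pairs spell an index
-- i in binary (2 ^ k ≥ n), and the value is that of the realization of Gᵢ on the shared cells if the
-- gate is ⊤, and ⊥ otherwise. To move to Gᵢ, Left claims in each pair the cell spelling i; Right must
-- answer beside it with ⊥, or Left completes a (⊤,⊤) pair; once all pairs are split Left opens the
-- gate and the game plays as the realization of Gᵢ. Conversely, Right closes the gate when Left plays
-- a shared cell, answers every claim in a pair, and after Left opens the gate challenges each open
-- pair with a ⊥ that Left must match; so Right either keeps the value ⊥ or Left lands in some Gᵢ.

module Submission where

open import Defs
open import Relation.Binary.Bundles using (Poset)
open import Data.Nat using (ℕ; _+_; _*_; NonZero)
open import Data.Nat.Logarithm using (⌈log₂_⌉)
open import Data.Fin using (Fin)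
open import Data.List.NonEmpty using ([_])

open import Data.Nat as ℕ using (zero; suc; _^_; _⊓_; _≤_; _<_; z≤n; s≤s; ⌈_/2⌉; ⌊_/2⌋)
import Data.Nat.Properties as ℕ
open import Data.Nat.Logarithm.Core using (⌈log2⌉)
open import Data.Nat.Induction using (<-wellFounded)
open import Induction.WellFounded using (Acc; acc)
open import Data.Fin as Fin using (toℕ; funToFin; finToFun)
import Data.Fin.Properties as Finₚ
open import Data.Bool as Bool using (Bool; true; false; not; if_then_else_; T?)
open import Data.Maybe using (Maybe; just; nothing; is-nothing; fromMaybe)
open import Data.Unit using (⊤; tt)
open import Data.List using ([]; _∷_; allFin)
open import Data.List.NonEmpty using (_∷_)
open import Data.List.Membership.Propositional using (_∈_)
open import Data.List.Membership.Propositional.Properties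
  using (∈-map⁻; ∈-map⁺; ∈-filter⁻; ∈-filter⁺; ∈-allFin; ∈-tabulate⁻; ∈-tabulate⁺)
open import Data.List.Relation.Unary.All as All using (All; []; _∷_)
open import Data.List.Relation.Unary.Any using (here; there)
open import Data.Product using (∃; ∃₂; _×_; _,_; proj₁; proj₂)
open import Data.Product.Function.NonDependent.Propositional using (_×-↔_)
open import Data.Sum as Sum using (_⊎_; inj₁; inj₂)
open import Data.Sum.Function.Propositional using (_⊎-↔_)
open import Function using (Inverse; _↔_; mk↔ₛ′; _∘_; case_of_)
open import Function.Properties.Inverse using (↔-refl; ↔-trans)
open import Relation.Nullary using (¬_; yes; no; contradiction)
open import Relation.Nullary.Decidable using (⌊_⌋)
open import Relation.Binary.PropositionalEquality hiding ([_])

module Games {c ℓ₁ ℓ₂} (P : Poset c ℓ₁ ℓ₂) where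
  open Poset P using () renaming (Carrier to A; _≤_ to _≤A_; trans to ≤A-trans)
  open GameOrder P

  private variable
    N : ℕ

  atom-≤G : ∀ {x y} → x ≤A y → atom x ≤G atom y
  atom-≤G x≤y = ≤G-intro (λ ()) (λ ()) (λ _ → ◁-atom x≤y)

  mutual
    atom-≤G-trans : ∀ {x y K} → x ≤A y → atom y ≤G K → atom x ≤G K
    atom-≤G-trans x≤y (≤G-intro _ hr ha) =
      ≤G-intro (λ ()) (λ m → atom-◁-trans x≤y (hr m)) (λ _ → atom-◁-trans x≤y (ha (inj₁ _)))

    atom-◁-trans : ∀ {x y K} → x ≤A y → atom y ◁ K → atom x ◁ K
    atom-◁-trans x≤y (◁-left m y≤KL) = ◁-left m (atom-≤G-trans x≤y y≤KL)
    atom-◁-trans x≤y (◁-atom y≤z)    = ◁-atom (≤A-trans x≤y y≤z)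

  mutual
    ≤G-atom-trans : ∀ {G y z} → G ≤G atom y → y ≤A z → G ≤G atom z
    ≤G-atom-trans (≤G-intro gl _ ga) y≤z =
      ≤G-intro (λ m → ◁-atom-trans (gl m) y≤z) (λ ()) (λ _ → ◁-atom-trans (ga (inj₂ _)) y≤z)

    ◁-atom-trans : ∀ {G y z} → G ◁ atom y → y ≤A z → G ◁ atom z
    ◁-atom-trans (◁-right m GR≤y) y≤z = ◁-right m (≤G-atom-trans GR≤y y≤z)
    ◁-atom-trans (◁-atom x≤y)     y≤z = ◁-atom (≤A-trans x≤y y≤z)

  -- Transitivity through an atom is proved separately, so that the induction below is structural
  -- in both derivations.
  mutual
    ≤G-trans : ∀ {G H K} → G ≤G H → H ≤G K → G ≤G K
    ≤G-trans G≤H@(≤G-intro gl _ ga) H≤K@(≤G-intro _ hr ha) =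
      ≤G-intro (λ m → ◁-≤G-trans (gl m) H≤K) (λ m → ≤G-◁-trans G≤H (hr m))
        Sum.[ (λ a → ◁-≤G-trans (ga (inj₁ a)) H≤K) , (λ a → ≤G-◁-trans G≤H (ha (inj₂ a))) ]

    ◁-≤G-trans : ∀ {G H K} → G ◁ H → H ≤G K → G ◁ K
    ◁-≤G-trans (◁-right m GR≤H) H≤K = ◁-right m (≤G-trans GR≤H H≤K)
    ◁-≤G-trans (◁-left m G≤HL) (≤G-intro hl _ _) = ≤G-◁-trans G≤HL (hl m)
    ◁-≤G-trans (◁-atom x≤y) (≤G-intro _ _ ha) with ha (inj₁ _)
    ... | ◁-left m y≤KL = ◁-left m (atom-≤G-trans x≤y y≤KL)
    ... | ◁-atom y≤z    = ◁-atom (≤A-trans x≤y y≤z)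

    ≤G-◁-trans : ∀ {G H K} → G ≤G H → H ◁ K → G ◁ K
    ≤G-◁-trans (≤G-intro _ gr _) (◁-right m HR≤K) = ◁-≤G-trans (gr m) HR≤K
    ≤G-◁-trans G≤H (◁-left m H≤KL) = ◁-left m (≤G-trans G≤H H≤KL)
    ≤G-◁-trans (≤G-intro _ _ ga) (◁-atom y≤z) with ga (inj₂ _)
    ... | ◁-right m GR≤y = ◁-right m (≤G-atom-trans GR≤y y≤z)
    ... | ◁-atom x≤y     = ◁-atom (≤A-trans x≤y y≤z)

  module _ {b : A} (least : ∀ y → b ≤A y) where
    mutual
      atom-least-≤G : ∀ H → atom b ≤G H
      atom-least-≤G (atom y)          = atom-≤G (least y)
      atom-least-≤G H@(node _ (r ∷ rs)) =
        ≤G-intro (λ ()) (All.lookup (atom-least-◁-all r rs)) (λ _ → atom-least-◁ H)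

      atom-least-◁ : ∀ H → atom b ◁ H
      atom-least-◁ (atom y)          = ◁-atom (least y)
      atom-least-◁ (node (l ∷ _) _) = ◁-left (here refl) (atom-least-≤G l)

      atom-least-◁-all : ∀ H Hs → All (atom b ◁_) (H ∷ Hs)
      atom-least-◁-all H []        = atom-least-◁ H ∷ []
      atom-least-◁-all H (H′ ∷ Hs) = atom-least-◁ H ∷ atom-least-◁-all H′ Hs

  module _ {t : A} (greatest : ∀ x → x ≤A t) where
    mutual
      ≤G-atom-greatest : ∀ G → G ≤G atom t
      ≤G-atom-greatest (atom x)          = atom-≤G (greatest x)
      ≤G-atom-greatest G@(node (l ∷ ls) _) =
        ≤G-intro (All.lookup (◁-atom-greatest-all l ls)) (λ ()) (λ _ → ◁-atom-greatest G)

      ◁-atom-greatest : ∀ G → G ◁ atom t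
      ◁-atom-greatest (atom x)          = ◁-atom (greatest x)
      ◁-atom-greatest (node _ (r ∷ _)) = ◁-right (here refl) (≤G-atom-greatest r)

      ◁-atom-greatest-all : ∀ G Gs → All (_◁ atom t) (G ∷ Gs)
      ◁-atom-greatest-all G []        = ◁-atom-greatest G ∷ []
      ◁-atom-greatest-all G (G′ ∷ Gs) = ◁-atom-greatest G ∷ ◁-atom-greatest-all G′ Gs

  Free : Position N → Fin N → Set
  Free q i = q i ≡ nothing

  -- Definitionally equal to setCell S of Defs, which does not use S.
  _[_≔_] : Position N → Fin N → Bool → Position N
  (q [ i ≔ b ]) j = if ⌊ j Fin.≟ i ⌋ then just b else q j

  ≔-same : ∀ (q : Position N) i b → (q [ i ≔ b ]) i ≡ just b
  ≔-same q i b with i Fin.≟ i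
  ... | yes _  = refl
  ... | no i≢i = contradiction refl i≢i

  ≔-other : ∀ (q : Position N) {i j} b → j ≢ i → (q [ i ≔ b ]) j ≡ q j
  ≔-other q {i} {j} b j≢i with j Fin.≟ i
  ... | yes j≡i = contradiction j≡i j≢i
  ... | no _    = refl

  ≔-keep : ∀ (q : Position N) {i j x} b → Free q i → q j ≡ just x → (q [ i ≔ b ]) j ≡ just x
  ≔-keep q {i} {j} b i-free qj≡x = trans (≔-other q b j≢i) qj≡x
    where
    j≢i : j ≢ i
    j≢i refl with trans (sym i-free) qj≡x
    ... | ()

  ≔-free : ∀ (q : Position N) {i j} b → Free (q [ i ≔ b ]) j → Free q j
  ≔-free q {i} {j} b free with j Fin.≟ i
  ... | no _ = free

  Extends : (Fin N → Bool) → Position N → Set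
  Extends u q = ∀ i {b} → q i ≡ just b → u i ≡ b

  fromMaybe-extends : ∀ d (q : Position N) → Extends (λ i → fromMaybe d (q i)) q
  fromMaybe-extends d q i qi≡b rewrite qi≡b = refl

  extends-≔ : ∀ {u : Fin N → Bool} q {i} b → Free q i →
              Extends u (q [ i ≔ b ]) → Extends u q
  extends-≔ q b free ext j qj≡b = ext j (≔-keep q b free qj≡b)

  -- eval F q is the whole game of q only when F ≥ #free q, so every argument about eval carries that bound.
  free? : Maybe Bool → ℕ
  free? nothing  = 1
  free? (just _) = 0

  #free : ∀ {N} → Position N → ℕ
  #free {zero}  q = 0
  #free {suc N} q = free? (q Fin.zero) + #free (λ i → q (Fin.suc i))

  free?-mono : ∀ x {x′} → (x′ ≡ nothing → x ≡ nothing) → free? x′ ≤ free? x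
  free?-mono x {just _}  sub = z≤n
  free?-mono x {nothing} sub rewrite sub refl = ℕ.≤-refl

  #free-mono : ∀ {N} (q q′ : Position N) → (∀ i → Free q′ i → Free q i) → #free q′ ≤ #free q
  #free-mono {zero}  q q′ sub = z≤n
  #free-mono {suc N} q q′ sub =
    ℕ.+-mono-≤ (free?-mono (q Fin.zero) (sub Fin.zero)) (#free-mono _ _ (λ i → sub (Fin.suc i)))

  #free-mono-< : ∀ {N} (q q′ : Position N) {j} → (∀ i → Free q′ i → Free q i) →
                 Free q j → ¬ Free q′ j → #free q′ < #free q
  #free-mono-< {suc N} q q′ {Fin.zero} sub free nonfree with q′ Fin.zero
  ... | nothing = contradiction refl nonfree
  ... | just _ rewrite free = s≤s (#free-mono _ _ (λ i → sub (Fin.suc i)))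
  #free-mono-< {suc N} q q′ {Fin.suc j} sub free nonfree =
    ℕ.+-mono-≤-< (free?-mono (q Fin.zero) (sub Fin.zero))
                 (#free-mono-< _ _ (λ i → sub (Fin.suc i)) free nonfree)

  #free-≔ : ∀ (q : Position N) {i} b → Free q i → #free (q [ i ≔ b ]) < #free q
  #free-≔ q {i} b free = #free-mono-< q (q [ i ≔ b ]) (λ j → ≔-free q b) free λ set-free →
    case trans (sym (≔-same q i b)) set-free of λ ()

  #free-≤ : ∀ {N} (q : Position N) → #free q ≤ N
  #free-≤ {zero}  q = z≤n
  #free-≤ {suc N} q = ℕ.+-mono-≤ {y = 1} (free?≤1 (q Fin.zero)) (#free-≤ _)
    where
    free?≤1 : ∀ x → free? x ≤ 1
    free?≤1 nothing  = ℕ.≤-refl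
    free?≤1 (just _) = z≤n

  fuel-≔ : ∀ (q : Position N) {i f} b → #free q ≤ suc f → Free q i → #free (q [ i ≔ b ]) ≤ f
  fuel-≔ q b fuel free = ℕ.≤-pred (ℕ.≤-trans (#free-≔ q b free) fuel)

  fuel-move : ∀ (q : Position N) {i F} b → #free q ≤ F → Free q i →
              ∃ λ f → F ≡ suc f × #free (q [ i ≔ b ]) ≤ f
  fuel-move q {F = zero}  b fuel free = contradiction (ℕ.≤-trans (#free-≔ q b free) fuel) λ ()
  fuel-move q {F = suc f} b fuel free = f , refl , fuel-≔ q b fuel free

  infix 4 _⊑_
  data _⊑_ : Maybe Bool → Maybe Bool → Set where
    ⊥⊑  : ∀ {x} → just false ⊑ x
    ⋆⊑⋆ : nothing ⊑ nothing
    ⋆⊑⊤ : nothing ⊑ just true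
    ⊤⊑⊤ : just true ⊑ just true

  ⊑⊤ : ∀ x → x ⊑ just true
  ⊑⊤ (just false) = ⊥⊑
  ⊑⊤ (just true)  = ⊤⊑⊤
  ⊑⊤ nothing      = ⋆⊑⊤

  ⊑-fromMaybe : ∀ {x y} → x ⊑ y → fromMaybe false x Bool.≤ fromMaybe false y
  ⊑-fromMaybe {y = just false} ⊥⊑ = Bool.b≤b
  ⊑-fromMaybe {y = just true}  ⊥⊑ = Bool.f≤t
  ⊑-fromMaybe {y = nothing}    ⊥⊑ = Bool.b≤b
  ⊑-fromMaybe ⋆⊑⋆ = Bool.b≤b
  ⊑-fromMaybe ⋆⊑⊤ = Bool.f≤t
  ⊑-fromMaybe ⊤⊑⊤ = Bool.b≤b

  module Play {N : ℕ} (S : MSCG N) where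
    open MSCG S

    ∈-stars⁻ : ∀ {q i} → i ∈ stars S q → Free q i
    ∈-stars⁻ {q} {i} i∈ with q i | proj₂ (∈-filter⁻ (λ j → T? (is-nothing (q j))) {xs = allFin N} i∈)
    ... | nothing | _ = refl

    ∈-stars⁺ : ∀ {q i} → Free q i → i ∈ stars S q
    ∈-stars⁺ {q} {i} free =
      ∈-filter⁺ (λ j → T? (is-nothing (q j))) (∈-allFin i) (subst (λ x → Bool.T (is-nothing x)) (sym free) _)

    eval-atom-or-move : ∀ F q → eval S F q ≡ atom (φ (colour S q)) ⊎ ∃₂ λ f i → F ≡ suc f × Free q i
    eval-atom-or-move zero    q = inj₁ refl
    eval-atom-or-move (suc f) q with stars S q in eq
    ... | []    = inj₁ refl
    ... | i ∷ _ = inj₂ (f , i , refl , ∈-stars⁻ (subst (i ∈_) (sym eq) (here refl)))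

    eval-lefts⁻ : ∀ {F q GL} → GL ∈ lefts (eval S F q) →
                  ∃₂ λ f i → F ≡ suc f × Free q i × GL ≡ eval S f (q [ i ≔ true ])
    eval-lefts⁻ {suc f} {q} GL∈ with stars S q in eq
    ... | _ ∷ _ with ∈-map⁻ (λ i → eval S f (q [ i ≔ true ])) GL∈
    ...   | i , i∈ , refl = f , i , refl , ∈-stars⁻ (subst (i ∈_) (sym eq) i∈) , refl

    eval-rights⁻ : ∀ {F q GR} → GR ∈ rights (eval S F q) →
                   ∃₂ λ f i → F ≡ suc f × Free q i × GR ≡ eval S f (q [ i ≔ false ])
    eval-rights⁻ {suc f} {q} GR∈ with stars S q in eq
    ... | _ ∷ _ with ∈-map⁻ (λ i → eval S f (q [ i ≔ false ])) GR∈
    ...   | i , i∈ , refl = f , i , refl , ∈-stars⁻ (subst (i ∈_) (sym eq) i∈) , refl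

    eval-lefts⁺ : ∀ f q {i} → Free q i → eval S f (q [ i ≔ true ]) ∈ lefts (eval S (suc f) q)
    eval-lefts⁺ f q {i} free with stars S q in eq
    ... | []    = case subst (i ∈_) eq (∈-stars⁺ free) of λ ()
    ... | _ ∷ _ = ∈-map⁺ (λ i → eval S f (q [ i ≔ true ])) (subst (i ∈_) eq (∈-stars⁺ free))

    eval-rights⁺ : ∀ f q {i} → Free q i → eval S f (q [ i ≔ false ]) ∈ rights (eval S (suc f) q)
    eval-rights⁺ f q {i} free with stars S q in eq
    ... | []    = case subst (i ∈_) eq (∈-stars⁺ free) of λ ()
    ... | _ ∷ _ = ∈-map⁺ (λ i → eval S f (q [ i ≔ false ])) (subst (i ∈_) eq (∈-stars⁺ free))

    AtLeast AtMost : A → Position N → Set _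
    AtLeast a q = ∀ u → Extends u q → a ≤A φ u
    AtMost  b q = ∀ u → Extends u q → φ u ≤A b

    mutual
      atom-≤G-eval : ∀ {a} F q → #free q ≤ F → AtLeast a q → atom a ≤G eval S F q
      atom-≤G-eval {a} F q fuel low = ≤G-intro (λ ()) right (λ _ → atom-◁-eval F q fuel low)
        where
        right : ∀ {GR} → GR ∈ rights (eval S F q) → atom a ◁ GR
        right GR∈ with eval-rights⁻ {F} {q} GR∈
        ... | f , i , refl , free , refl =
          atom-◁-eval f _ (fuel-≔ q false fuel free) (λ u → low u ∘ extends-≔ q false free)

      atom-◁-eval : ∀ {a} F q → #free q ≤ F → AtLeast a q → atom a ◁ eval S F q
      atom-◁-eval {a} F q fuel low with eval-atom-or-move F q
      ... | inj₁ eq = subst (atom a ◁_) (sym eq) (◁-atom (low _ (fromMaybe-extends false q)))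
      ... | inj₂ (f , i , refl , free) =
        ◁-left (eval-lefts⁺ f q free)
          (atom-≤G-eval f _ (fuel-≔ q true fuel free) (λ u → low u ∘ extends-≔ q true free))

    module RightKeeps {ℓ} {b : A} (Inv : Position N → Set ℓ)
      (inv-value : ∀ {q} → Inv q → φ (colour S q) ≤A b)
      (inv-≔false : ∀ {q i} → Inv q → Free q i → Inv (q [ i ≔ false ]))
      (inv-reply : ∀ {q i} → Inv q → Free q i →
                   Inv (q [ i ≔ true ]) ⊎
                   ∃ λ j → Free (q [ i ≔ true ]) j × Inv (q [ i ≔ true ] [ j ≔ false ]))
      where

      mutual
        eval-≤G-atom : ∀ F q → #free q ≤ F → Inv q → eval S F q ≤G atom b
        eval-≤G-atom F q fuel inv = ≤G-intro left (λ ()) (λ _ → eval-◁-atom F q fuel inv)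
          where
          left : ∀ {GL} → GL ∈ lefts (eval S F q) → GL ◁ atom b
          left GL∈ with eval-lefts⁻ {F} {q} GL∈
          ... | f , i , refl , free , refl with inv-reply inv free
          ...   | inj₁ inv′ = eval-◁-atom f _ (fuel-≔ q true fuel free) inv′
          ...   | inj₂ (j , free′ , inv′)
            with fuel-move (q [ i ≔ true ]) false (fuel-≔ q true fuel free) free′
          ...     | f′ , refl , fuel′ = ◁-right (eval-rights⁺ f′ _ free′) (eval-≤G-atom f′ _ fuel′ inv′)

        eval-◁-atom : ∀ F q → #free q ≤ F → Inv q → eval S F q ◁ atom b
        eval-◁-atom F q fuel inv with eval-atom-or-move F q
        ... | inj₁ eq = subst (_◁ atom b) (sym eq) (◁-atom (inv-value inv))
        ... | inj₂ (f , i , refl , free) =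
          ◁-right (eval-rights⁺ f q free) (eval-≤G-atom f _ (fuel-≔ q false fuel free) (inv-≔false inv free))

    eval-≤G-atom : ∀ {b F q} → AtMost b q → #free q ≤ F → eval S F q ≤G atom b
    eval-≤G-atom {b} {F} {q} high fuel = RightKeeps.eval-≤G-atom (AtMost b)
      (λ {q} high → high _ (fromMaybe-extends false q))
      (λ {q} high free u → high u ∘ extends-≔ q false free)
      (λ {q} high free → inj₁ λ u → high u ∘ extends-≔ q true free)
      F q fuel high

  module Simulation {M N : ℕ} (S : MSCG M) (T : MSCG N) (_~_ : Fin M → Fin N → Set)
    (~-functional : ∀ {i j j′} → i ~ j → i ~ j′ → j ≡ j′)
    (~-injective  : ∀ {i i′ j} → i ~ j → i′ ~ j → i ≡ i′)
    (partnerˡ? : ∀ i → (∃ λ j → i ~ j) ⊎ (∀ j → ¬ i ~ j))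
    (partnerʳ? : ∀ j → (∃ λ i → i ~ j) ⊎ (∀ i → ¬ i ~ j))
    where
    module S = Play S
    module T = Play T

    -- Each move on a matched cell is copied to its partner; moves on unmatched cells need no answer.

    Below : Position M → Position N → Set
    Below q r = ∀ {i j} → i ~ j → q i ⊑ r j

    Dominated : Position M → Position N → Set _
    Dominated q r = ∀ u v → Extends u q → Extends v r →
                    (∀ {i j} → i ~ j → u i Bool.≤ v j) → MSCG.φ S u ≤A MSCG.φ T v

    below-≔ˡ : ∀ {q r i b} → Below q r → (∀ {j} → i ~ j → just b ⊑ r j) → Below (q [ i ≔ b ]) r
    below-≔ˡ {q} {r} {i} {b} below new {i′} i′~j with i′ Fin.≟ i
    ... | yes refl = new i′~j
    ... | no _     = below i′~j

    below-≔ʳ : ∀ {q r j b} → Below q r → (∀ {i} → i ~ j → q i ⊑ just b) → Below q (r [ j ≔ b ])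
    below-≔ʳ {q} {r} {j} {b} below new {i} {j′} i~j′ with j′ Fin.≟ j
    ... | yes refl = new i~j′
    ... | no _     = below i~j′

    dominated-≔ˡ : ∀ {q r i} b → Free q i → Dominated q r → Dominated (q [ i ≔ b ]) r
    dominated-≔ˡ {q} b free dom u v eu ev = dom u v (extends-≔ q b free eu) ev

    dominated-≔ʳ : ∀ {q r j} b → Free r j → Dominated q r → Dominated q (r [ j ≔ b ])
    dominated-≔ʳ {r = r} b free dom u v eu ev = dom u v eu (extends-≔ r b free ev)

    ≔-partnerʳ : ∀ r {i j j′} b → i ~ j → i ~ j′ → (r [ j ≔ b ]) j′ ≡ just b
    ≔-partnerʳ r b i~j i~j′ with refl ← ~-functional i~j′ i~j = ≔-same r _ b

    ≔-partnerˡ : ∀ q {i i′ j} b → i ~ j → i′ ~ j → (q [ i ≔ b ]) i′ ≡ just b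
    ≔-partnerˡ q b i~j i′~j with refl ← ~-injective i′~j i~j = ≔-same q _ b

    mutual
      simulate : ∀ F F′ q r → #free q ≤ F → #free r ≤ F′ → Below q r → Dominated q r →
                 eval S F q ≤G eval T F′ r
      simulate F F′ q r fq fr below dom = ≤G-intro left right (λ _ → simulate-◁ F F′ q r fq fr below dom)
        where
        left : ∀ {GL} → GL ∈ lefts (eval S F q) → GL ◁ eval T F′ r
        left GL∈ with S.eval-lefts⁻ {F} {q} GL∈
        ... | f , i , refl , free , refl with partnerˡ? i
        ...   | inj₂ none =
          simulate-◁ f F′ _ r (fuel-≔ q true fq free) fr
            (below-≔ˡ below λ i~j → contradiction i~j (none _)) (dominated-≔ˡ true free dom)
        ...   | inj₁ (j , i~j) with r j in rj | below i~j
        ...     | just true | _ =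
          simulate-◁ f F′ _ r (fuel-≔ q true fq free) fr
            (below-≔ˡ below λ i~j′ → subst (_ ⊑_) (sym (trans (cong r (~-functional i~j′ i~j)) rj)) ⊤⊑⊤)
            (dominated-≔ˡ true free dom)
        ...     | nothing | _ with fuel-move r true fr rj
        ...       | f′ , refl , fr′ =
          ◁-left (T.eval-lefts⁺ f′ r rj)
            (simulate f f′ _ _ (fuel-≔ q true fq free) fr′
              (below-≔ˡ (below-≔ʳ below λ _ → ⊑⊤ _)
                        λ i~j′ → subst (_ ⊑_) (sym (≔-partnerʳ r true i~j i~j′)) ⊤⊑⊤)
              (dominated-≔ʳ true rj (dominated-≔ˡ true free dom)))
        left GL∈ | f , i , refl , free , refl | inj₁ (j , i~j) | just false | q⊑r
          rewrite free with () ← q⊑r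

        right : ∀ {GR} → GR ∈ rights (eval T F′ r) → eval S F q ◁ GR
        right GR∈ with T.eval-rights⁻ {F′} {r} GR∈
        ... | f′ , j , refl , free , refl with partnerʳ? j
        ...   | inj₂ none =
          simulate-◁ F f′ q _ fq (fuel-≔ r false fr free)
            (below-≔ʳ below λ i~j → contradiction i~j (none _)) (dominated-≔ʳ false free dom)
        ...   | inj₁ (i , i~j) with q i in qi | below i~j
        ...     | just false | _ =
          simulate-◁ F f′ q _ fq (fuel-≔ r false fr free)
            (below-≔ʳ below λ i′~j → subst (_⊑ _) (sym (trans (cong q (~-injective i′~j i~j)) qi)) ⊥⊑)
            (dominated-≔ʳ false free dom)
        ...     | nothing | _ with fuel-move q false fq qi
        ...       | f , refl , fq′ =
          ◁-right (S.eval-rights⁺ f q qi)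
            (simulate f f′ _ _ fq′ (fuel-≔ r false fr free)
              (below-≔ʳ (below-≔ˡ below λ _ → ⊥⊑)
                        λ i′~j → subst (_⊑ _) (sym (≔-partnerˡ q false i~j i′~j)) ⊥⊑)
              (dominated-≔ʳ false free (dominated-≔ˡ false qi dom)))
        right GR∈ | f′ , j , refl , free , refl | inj₁ (i , i~j) | just true | q⊑r
          rewrite free with () ← q⊑r

      simulate-◁ : ∀ F F′ q r → #free q ≤ F → #free r ≤ F′ → Below q r → Dominated q r →
                   eval S F q ◁ eval T F′ r
      simulate-◁ F F′ q r fq fr below dom with S.eval-atom-or-move F q | T.eval-atom-or-move F′ r
      ... | inj₂ (f , i , refl , free) | _ =
        ◁-right (S.eval-rights⁺ f q free)
          (simulate f F′ _ r (fuel-≔ q false fq free) fr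
            (below-≔ˡ below λ _ → ⊥⊑) (dominated-≔ˡ false free dom))
      ... | inj₁ _ | inj₂ (f′ , j , refl , free) =
        ◁-left (T.eval-lefts⁺ f′ r free)
          (simulate F f′ q _ fq (fuel-≔ r true fr free)
            (below-≔ʳ below λ _ → ⊑⊤ _) (dominated-≔ʳ true free dom))
      ... | inj₁ q-full | inj₁ r-full =
        subst₂ _◁_ (sym q-full) (sym r-full)
          (◁-atom (dom _ _ (fromMaybe-extends false q) (fromMaybe-extends false r) (⊑-fromMaybe ∘ below)))

preimage? : ∀ {M N} (ι : Fin M → Fin N) l → (∃ λ j → ι j ≡ l) ⊎ (∀ j → ι j ≢ l)
preimage? ι l with Finₚ.any? (λ j → ι j Fin.≟ l)
... | yes found = inj₁ found
... | no none   = inj₂ λ j ιj≡l → none (j , ιj≡l)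

data Verdict : Set where
  decided   : Bool → Verdict
  undecided : Verdict

infix 4 _≼_
data _≼_ : Verdict → Verdict → Set where
  decided-false≼ : ∀ {v} → decided false ≼ v
  ≼decided-true  : ∀ {v} → v ≼ decided true
  undecided≼     : undecided ≼ undecided

step : Bool → Bool → Verdict → Verdict
step true  true  _ = decided true
step false false _ = decided false
step true  false v = v
step false true  v = v

scan : ∀ {k} → (Fin k → Bool) → (Fin k → Bool) → Verdict
scan {zero}  a b = undecided
scan {suc k} a b = step (a Fin.zero) (b Fin.zero) (scan (a ∘ Fin.suc) (b ∘ Fin.suc))

Split : ∀ {k} → (Fin k → Bool) → (Fin k → Bool) → Fin k → Set
Split a b t = b t ≡ not (a t)

scan-undecided : ∀ {k} (a b : Fin k → Bool) → (∀ t → Split a b t) → scan a b ≡ undecided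
scan-undecided {zero}  a b split = refl
scan-undecided {suc k} a b split with a Fin.zero | b Fin.zero | split Fin.zero
... | true  | false | _ = scan-undecided _ _ (split ∘ Fin.suc)
... | false | true  | _ = scan-undecided _ _ (split ∘ Fin.suc)

scan-undecided⁻ : ∀ {k} (a b : Fin k → Bool) → scan a b ≡ undecided → ∀ t → Split a b t
scan-undecided⁻ {suc k} a b eq t with a Fin.zero in a₀ | b Fin.zero in b₀
scan-undecided⁻ {suc k} a b () t | true | true
scan-undecided⁻ {suc k} a b () t | false | false
scan-undecided⁻ {suc k} a b eq Fin.zero    | true  | false = trans b₀ (cong not (sym a₀))
scan-undecided⁻ {suc k} a b eq Fin.zero    | false | true  = trans b₀ (cong not (sym a₀))
scan-undecided⁻ {suc k} a b eq (Fin.suc t) | true  | false = scan-undecided⁻ _ _ eq t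
scan-undecided⁻ {suc k} a b eq (Fin.suc t) | false | true  = scan-undecided⁻ _ _ eq t

scan-decided : ∀ {k} (a b : Fin k → Bool) t₀ x → (∀ t → t Fin.< t₀ → Split a b t) →
               a t₀ ≡ x → b t₀ ≡ x → scan a b ≡ decided x
scan-decided {suc k} a b Fin.zero x split a₀ b₀ rewrite a₀ | b₀ with x
... | true  = refl
... | false = refl
scan-decided {suc k} a b (Fin.suc t₀) x split a₀ b₀ with a Fin.zero | b Fin.zero | split Fin.zero (s≤s z≤n)
... | true  | false | _ = scan-decided _ _ t₀ x (λ t t<t₀ → split (Fin.suc t) (s≤s t<t₀)) a₀ b₀
... | false | true  | _ = scan-decided _ _ t₀ x (λ t t<t₀ → split (Fin.suc t) (s≤s t<t₀)) a₀ b₀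

scan-not-true : ∀ {k} (a b : Fin k → Bool) → (∀ t → a t ≡ true → b t ≢ true) → scan a b ≢ decided true
scan-not-true {suc k} a b guard eq with a Fin.zero in a₀ | b Fin.zero in b₀
... | true  | true  = guard Fin.zero a₀ b₀
... | true  | false = scan-not-true _ _ (guard ∘ Fin.suc) eq
... | false | true  = scan-not-true _ _ (guard ∘ Fin.suc) eq

step-mono : ∀ {x x′ y y′ v v′} → x Bool.≤ x′ → y Bool.≤ y′ → v ≼ v′ → step x y v ≼ step x′ y′ v′
step-mono {true}  {y = true}  Bool.b≤b Bool.b≤b _    = ≼decided-true
step-mono {false} {y = false} _        _        _    = decided-false≼
step-mono {true}  {y = false} Bool.b≤b Bool.b≤b v≼v′ = v≼v′
step-mono {true}  {y = false} Bool.b≤b Bool.f≤t _    = ≼decided-true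
step-mono {false} {y = true}  Bool.b≤b Bool.b≤b v≼v′ = v≼v′
step-mono {false} {y = true}  Bool.f≤t Bool.b≤b _    = ≼decided-true

scan-mono : ∀ {k} {a a′ b b′ : Fin k → Bool} → (∀ t → a t Bool.≤ a′ t) → (∀ t → b t Bool.≤ b′ t) →
            scan a b ≼ scan a′ b′
scan-mono {zero}  a≤a′ b≤b′ = undecided≼
scan-mono {suc k} a≤a′ b≤b′ =
  step-mono (a≤a′ Fin.zero) (b≤b′ Fin.zero) (scan-mono (a≤a′ ∘ Fin.suc) (b≤b′ ∘ Fin.suc))

funToFin-cong : ∀ {k m} {f g : Fin k → Fin m} → (∀ t → f t ≡ g t) → funToFin f ≡ funToFin g
funToFin-cong {zero}  f≗g = refl
funToFin-cong {suc k} f≗g = cong₂ Fin.combine (f≗g Fin.zero) (funToFin-cong (f≗g ∘ Fin.suc))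

clamp : ∀ {m n₀} → Fin m → Fin (suc n₀)
clamp {n₀ = n₀} j = Fin.fromℕ< (s≤s (ℕ.m⊓n≤n (toℕ j) n₀))

clamp-inject≤ : ∀ {m n₀} (i : Fin (suc n₀)) (le : suc n₀ ≤ m) → clamp (Fin.inject≤ i le) ≡ i
clamp-inject≤ {n₀ = n₀} i le = Finₚ.toℕ-injective (begin
  toℕ (clamp (Fin.inject≤ i le))   ≡⟨ Finₚ.toℕ-fromℕ< _ ⟩
  toℕ (Fin.inject≤ i le) ⊓ n₀      ≡⟨ cong (_⊓ n₀) (Finₚ.toℕ-inject≤ i le) ⟩
  toℕ i ⊓ n₀                       ≡⟨ ℕ.m≤n⇒m⊓n≡m (ℕ.≤-pred (Finₚ.toℕ<n i)) ⟩
  toℕ i                            ∎)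
  where open ≡-Reasoning

-- Bit blocks whose value is at least n name the last index.
select : ∀ {k n₀} → (Fin k → Bool) → Fin (suc n₀)
select β = clamp (funToFin (Inverse.from Finₚ.2↔Bool ∘ β))

select-cong : ∀ {k n₀} {β β′ : Fin k → Bool} → (∀ t → β t ≡ β′ t) → select {n₀ = n₀} β ≡ select β′
select-cong β≗β′ = cong clamp (funToFin-cong (cong (Inverse.from Finₚ.2↔Bool) ∘ β≗β′))

select-surjective : ∀ {k n₀} → suc n₀ ≤ 2 ^ k → ∀ i → ∃ λ (β : Fin k → Bool) → select β ≡ i
select-surjective {k} le i = β , (begin
  clamp (funToFin (Inverse.from Finₚ.2↔Bool ∘ β))
    ≡⟨ cong clamp (funToFin-cong (Inverse.strictlyInverseʳ Finₚ.2↔Bool ∘ digits)) ⟩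
  clamp (funToFin digits)                          ≡⟨ cong clamp (Finₚ.funToFin-finToFin {k} {2} j) ⟩
  clamp j                                          ≡⟨ clamp-inject≤ i le ⟩
  i                                                ∎)
  where
  open ≡-Reasoning
  j = Fin.inject≤ i le
  digits = finToFun {2} {k} j
  β = Inverse.to Finₚ.2↔Bool ∘ digits

all-or-least : ∀ {k ℓ ℓ′} {X : Fin k → Set ℓ} {Y : Fin k → Set ℓ′} → (∀ t → X t ⊎ Y t) →
               (∀ t → Y t) ⊎ ∃ λ t₀ → X t₀ × (∀ t → t Fin.< t₀ → Y t)
all-or-least {zero}  x⊎y = inj₁ λ ()
all-or-least {suc k} x⊎y with x⊎y Fin.zero | all-or-least (x⊎y ∘ Fin.suc)
... | inj₁ x₀ | _                    = inj₂ (Fin.zero , x₀ , λ _ ())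
... | inj₂ y₀ | inj₁ ys              = inj₁ λ { Fin.zero → y₀ ; (Fin.suc t) → ys t }
... | inj₂ y₀ | inj₂ (t₀ , x , ys<) =
  inj₂ (Fin.suc t₀ , x , λ { Fin.zero _ → y₀ ; (Fin.suc t) (s≤s t<t₀) → ys< t t<t₀ })

module Construction {c ℓ₁ ℓ₂} (P : Poset c ℓ₁ ℓ₂)
  (top bot : Poset.Carrier P)
  (top-greatest : ∀ x → Poset._≤_ P x top) (bot-least : ∀ x → Poset._≤_ P bot x)
  {n₀ : ℕ} (G : Fin (suc n₀) → Game (Poset.Carrier P)) (p : Fin (suc n₀) → ℕ)
  (realized : ∀ i → GameOrder.Realizable P (G i) (p i))
  (m k : ℕ) (p≤m : ∀ i → p i ≤ m) (n≤2^k : suc n₀ ≤ 2 ^ k)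
  where
  open Poset P using () renaming (Carrier to A; _≤_ to _≤A_; refl to ≤A-refl)
  open GameOrder P
  open Games P

  -- sub j: the shared cells of the realizations; pair s t: side s of the t-th selector pair.
  data Cell : Set where
    sub  : Fin m → Cell
    pair : Bool → Fin k → Cell
    gate : Cell

  N : ℕ
  N = m + 2 * k + 1

  cells : Fin N ↔ Cell
  cells = ↔-trans Finₚ.+↔⊎ (↔-trans (↔-trans Finₚ.+↔⊎ (↔-refl ⊎-↔ selectors) ⊎-↔ Finₚ.1↔⊤) layout)
    where
    selectors : Fin (2 * k) ↔ (Bool × Fin k)
    selectors = ↔-trans Finₚ.*↔× (Finₚ.2↔Bool ×-↔ ↔-refl)
    layout : ((Fin m ⊎ (Bool × Fin k)) ⊎ ⊤) ↔ Cell
    layout = mk↔ₛ′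
      (λ { (inj₁ (inj₁ j)) → sub j ; (inj₁ (inj₂ (s , t))) → pair s t ; (inj₂ tt) → gate })
      (λ { (sub j) → inj₁ (inj₁ j) ; (pair s t) → inj₁ (inj₂ (s , t)) ; gate → inj₂ tt })
      (λ { (sub j) → refl ; (pair s t) → refl ; gate → refl })
      (λ { (inj₁ (inj₁ j)) → refl ; (inj₁ (inj₂ (s , t))) → refl ; (inj₂ tt) → refl })

  ⌜_⌝ : Cell → Fin N
  ⌜_⌝ = Inverse.from cells

  ⌜⌝-injective : ∀ {c c′} → ⌜ c ⌝ ≡ ⌜ c′ ⌝ → c ≡ c′
  ⌜⌝-injective {c} {c′} eq = begin
    c                        ≡⟨ Inverse.strictlyInverseˡ cells c ⟨
    Inverse.to cells ⌜ c ⌝   ≡⟨ cong (Inverse.to cells) eq ⟩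
    Inverse.to cells ⌜ c′ ⌝  ≡⟨ Inverse.strictlyInverseˡ cells c′ ⟩
    c′                       ∎
    where open ≡-Reasoning

  cell-view : ∀ l → ∃ λ c → ⌜ c ⌝ ≡ l
  cell-view l = Inverse.to cells l , Inverse.strictlyInverseʳ cells l

  realization : ∀ i → MSCG (p i)
  realization i = proj₁ (realized i)

  embed : ∀ i → Fin (p i) → Fin N
  embed i j = ⌜ sub (Fin.inject≤ j (p≤m i)) ⌝

  embed-injective : ∀ i {j j′} → embed i j ≡ embed i j′ → j ≡ j′
  embed-injective i {j} {j′} eq = Finₚ.inject≤-injective _ _ j j′ (sub-injective (⌜⌝-injective eq))
    where
    sub-injective : ∀ {x y} → sub x ≡ sub y → x ≡ y
    sub-injective refl = refl

  bits : Bool → (Fin N → Bool) → Fin k → Bool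
  bits s u t = u ⌜ pair s t ⌝

  leafValue : Fin (suc n₀) → (Fin N → Bool) → A
  leafValue i u = MSCG.φ (realization i) (u ∘ embed i)

  value : Verdict → (Fin N → Bool) → A
  value (decided true)  u = top
  value (decided false) u = bot
  value undecided       u = if u ⌜ gate ⌝ then leafValue (select (bits true u)) u else bot

  verdict : (Fin N → Bool) → Verdict
  verdict u = scan (bits true u) (bits false u)

  φ : (Fin N → Bool) → A
  φ u = value (verdict u) u

  split-agree : ∀ {x x′ y y′} → x Bool.≤ x′ → y Bool.≤ y′ → y ≡ not x → y′ ≡ not x′ → x ≡ x′
  split-agree Bool.b≤b _ _    _    = refl
  split-agree Bool.f≤t () refl refl

  φ-mono : ∀ u v → (∀ l → u l Bool.≤ v l) → φ u ≤A φ v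
  φ-mono u v u≤v with verdict u in eu | verdict v in ev
                   | scan-mono {a = bits true u} {bits true v} {bits false u} {bits false v} (u≤v ∘ _) (u≤v ∘ _)
  ... | _ | _ | decided-false≼ = bot-least _
  ... | _ | _ | ≼decided-true  = top-greatest _
  ... | _ | _ | undecided≼ with u ⌜ gate ⌝ | v ⌜ gate ⌝ | u≤v ⌜ gate ⌝
  ...   | false | _    | _ = bot-least _
  ...   | true  | true | _ =
    subst (λ i → leafValue (select (bits true u)) u ≤A leafValue i v) same-selection
      (MSCG.mono (realization _) _ _ (u≤v ∘ embed _))
    where
    same-selection : select (bits true u) ≡ select {n₀ = n₀} (bits true v)
    same-selection = select-cong {β = bits true u} {bits true v} λ t →
      split-agree (u≤v _) (u≤v _) (scan-undecided⁻ _ _ eu t) (scan-undecided⁻ _ _ ev t)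

  S : MSCG N
  S = record { φ = φ ; mono = φ-mono }

  open Play S

  choice : Game A
  choice = node (fromFin⁺ (suc n₀) G) [ atom bot ]

  G∈lefts-choice : ∀ i → G i ∈ lefts choice
  G∈lefts-choice Fin.zero    = here refl
  G∈lefts-choice (Fin.suc i) = there (∈-tabulate⁺ i)

  lefts-choice⁻ : ∀ {GL} → GL ∈ lefts choice → ∃ λ i → GL ≡ G i
  lefts-choice⁻ (here refl)  = Fin.zero , refl
  lefts-choice⁻ (there GL∈) with ∈-tabulate⁻ GL∈
  ... | i , refl = Fin.suc i , refl

  ≔-elsewhere : ∀ q c b c′ → c′ ≢ c → (q [ ⌜ c ⌝ ≔ b ]) ⌜ c′ ⌝ ≡ q ⌜ c′ ⌝
  ≔-elsewhere q c b c′ c′≢c = ≔-other q b (c′≢c ∘ ⌜⌝-injective)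

  State : Set
  State = Maybe Bool × Maybe Bool

  pairAt : Position N → Fin k → State
  pairAt q t = q ⌜ pair true t ⌝ , q ⌜ pair false t ⌝

  split : Bool → State
  split b = just b , just (not b)

  Settled : State → Set
  Settled st = st ≡ (nothing , nothing) ⊎ ∃ λ b → st ≡ split b

  Guarded : State → Set
  Guarded (x , y) = (x ≡ just true → y ≡ just false) × (y ≡ just true → x ≡ just false)

  split-guarded : ∀ b → Guarded (split b)
  split-guarded true  = (λ _ → refl) , λ ()
  split-guarded false = (λ ()) , λ _ → refl

  split-by : ∀ q {s t} → q ⌜ pair s t ⌝ ≡ just true → q ⌜ pair (not s) t ⌝ ≡ just false → pairAt q t ≡ split s
  split-by q {true}  own other = cong₂ _,_ own other
  split-by q {false} own other = cong₂ _,_ other own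

  pairAt-≔-elsewhere : ∀ (Pr : State → Set) q c b t → (∀ s → pair s t ≢ c) →
                       Pr (pairAt q t) → Pr (pairAt (q [ ⌜ c ⌝ ≔ b ]) t)
  pairAt-≔-elsewhere Pr q c b t outside =
    subst Pr (sym (cong₂ _,_ (≔-elsewhere q c b _ (outside true)) (≔-elsewhere q c b _ (outside false))))

  pairAt-≔-keep : ∀ q {l t x y} b → Free q l → pairAt q t ≡ (just x , just y) →
                  pairAt (q [ l ≔ b ]) t ≡ (just x , just y)
  pairAt-≔-keep q b free eq =
    cong₂ _,_ (≔-keep q b free (cong proj₁ eq)) (≔-keep q b free (cong proj₂ eq))

  pair-other : ∀ {s s′ t t′} → t ≢ t′ → pair s t ≢ pair s′ t′
  pair-other t≢t′ refl = t≢t′ refl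

  pairs-≔ : ∀ (Pr : Fin k → State → Set) q s t₀ b → (∀ t → t ≢ t₀ → Pr t (pairAt q t)) →
            Pr t₀ (pairAt (q [ ⌜ pair s t₀ ⌝ ≔ b ]) t₀) → ∀ t → Pr t (pairAt (q [ ⌜ pair s t₀ ⌝ ≔ b ]) t)
  pairs-≔ Pr q s t₀ b others at-t₀ t with t Fin.≟ t₀
  ... | yes refl = at-t₀
  ... | no t≢t₀  = pairAt-≔-elsewhere (Pr t) q (pair s t₀) b t (λ _ → pair-other t≢t₀) (others t t≢t₀)

  extends-pairAt : ∀ {u q t x y} → Extends u q → pairAt q t ≡ (just x , just y) →
                   bits true u t ≡ x × bits false u t ≡ y
  extends-pairAt ext eq = ext _ (cong proj₁ eq) , ext _ (cong proj₂ eq)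

  extends-split : ∀ {u q t b} → Extends u q → pairAt q t ≡ split b →
                  bits true u t ≡ b × Split (bits true u) (bits false u) t
  extends-split ext eq with extends-pairAt ext eq
  ... | a≡b , b≡¬b = a≡b , trans b≡¬b (cong not (sym a≡b))

  SplitBefore : Position N → Fin k → Set
  SplitBefore q t₀ = ∀ t → t Fin.< t₀ → ∃ λ b → pairAt q t ≡ split b

  splitBefore-≔ : ∀ q {l t₀} b → Free q l → SplitBefore q t₀ → SplitBefore (q [ l ≔ b ]) t₀
  splitBefore-≔ q b free before t t<t₀ with before t t<t₀
  ... | s , eq = s , pairAt-≔-keep q b free eq

  verdict-decided : ∀ {u q t₀ x} → Extends u q → SplitBefore q t₀ → pairAt q t₀ ≡ (just x , just x) →
                    verdict u ≡ decided x
  verdict-decided {t₀ = t₀} {x} ext before eq =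
    scan-decided _ _ t₀ x (λ t t<t₀ → proj₂ (extends-split ext (proj₂ (before t t<t₀)))) a≡x b≡x
    where
    a≡x = proj₁ (extends-pairAt ext eq)
    b≡x = proj₂ (extends-pairAt ext eq)

  top-forced : ∀ {q t₀} → SplitBefore q t₀ → pairAt q t₀ ≡ (just true , just true) → AtLeast top q
  top-forced before eq u ext = subst (λ v → top ≤A value v u) (sym (verdict-decided ext before eq)) ≤A-refl

  bot-forced : ∀ {q t₀} → SplitBefore q t₀ → pairAt q t₀ ≡ (just false , just false) → AtMost bot q
  bot-forced before eq u ext = subst (λ v → value v u ≤A bot) (sym (verdict-decided ext before eq)) ≤A-refl

  SubFree : Position N → Set
  SubFree q = ∀ j → Free q ⌜ sub j ⌝

  Leaf : (Fin k → Bool) → Position N → Set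
  Leaf β q = q ⌜ gate ⌝ ≡ just true × SubFree q × ∀ t → pairAt q t ≡ split (β t)

  leaf-φ : ∀ {β q u} → Leaf β q → Extends u q → φ u ≡ leafValue (select β) u
  leaf-φ {β} {q} {u} (gate⊤ , _ , splits) ext = begin
    φ u                                  ≡⟨ cong (λ v → value v u) (scan-undecided _ _ (proj₂ ∘ selected)) ⟩
    value undecided u                    ≡⟨ cong (λ g → if g then leafValue chosen u else bot) (ext _ gate⊤) ⟩
    leafValue chosen u                   ≡⟨ cong (λ i → leafValue i u) (select-cong (proj₁ ∘ selected)) ⟩
    leafValue (select β) u               ∎
    where
    open ≡-Reasoning
    chosen = select (bits true u)
    selected : ∀ t → _
    selected t = extends-split ext (splits t)

  private
    module ToRealization (i : Fin (suc n₀)) = Simulation S (realization i) (λ l j → embed i j ≡ l)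
      (λ ιj≡l ιj′≡l → embed-injective i (trans ιj≡l (sym ιj′≡l))) (λ ιj≡l ιj≡l′ → trans (sym ιj≡l) ιj≡l′)
      (preimage? (embed i)) (λ j → inj₁ (embed i j , refl))
    module FromRealization (i : Fin (suc n₀)) = Simulation (realization i) S (λ j l → embed i j ≡ l)
      (λ ιj≡l ιj≡l′ → trans (sym ιj≡l) ιj≡l′) (λ ιj≡l ιj′≡l → embed-injective i (trans ιj≡l (sym ιj′≡l)))
      (λ j → inj₁ (embed i j , refl)) (preimage? (embed i))

  leaf-≤G : ∀ {β F q} → Leaf β q → #free q ≤ F → eval S F q ≤G G (select β)
  leaf-≤G {β} {F} {q} leaf@(_ , sub-free , _) fuel =
    ≤G-trans (ToRealization.simulate i F (p i) q (λ _ → nothing) fuel (#free-≤ _) below dominated)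
             (proj₂ (proj₂ (realized i)))
    where
    i = select β
    below : ToRealization.Below i q (λ _ → nothing)
    below refl = subst (_⊑ nothing) (sym (sub-free _)) ⋆⊑⋆
    dominated : ToRealization.Dominated i q (λ _ → nothing)
    dominated u v ext _ u≤v =
      subst (_≤A _) (sym (leaf-φ leaf ext)) (MSCG.mono (realization i) _ _ (λ j → u≤v refl))

  ≤G-leaf : ∀ {β F q} → Leaf β q → #free q ≤ F → G (select β) ≤G eval S F q
  ≤G-leaf {β} {F} {q} leaf@(_ , sub-free , _) fuel =
    ≤G-trans (proj₁ (proj₂ (realized i)))
             (FromRealization.simulate i (p i) F (λ _ → nothing) q (#free-≤ _) fuel below dominated)
    where
    i = select β
    below : FromRealization.Below i (λ _ → nothing) q
    below refl = subst (nothing ⊑_) (sym (sub-free _)) ⋆⊑⋆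
    dominated : FromRealization.Dominated i (λ _ → nothing) q
    dominated v u _ ext v≤u =
      subst (_ ≤A_) (sym (leaf-φ leaf ext)) (MSCG.mono (realization i) _ _ (λ j → v≤u refl))

  kill-◁ : ∀ {F q t₀} → #free q ≤ F → SplitBefore q t₀ → Free q ⌜ pair true t₀ ⌝ →
           q ⌜ pair false t₀ ⌝ ≡ just false → ∀ H → eval S F q ◁ H
  kill-◁ {q = q} fuel before free b⊥ H with fuel-move q false fuel free
  ... | f , refl , fuel′ =
    ◁-right (eval-rights⁺ f q free)
      (≤G-trans (eval-≤G-atom (bot-forced (splitBefore-≔ q false free before) killed) fuel′)
                (atom-least-≤G bot-least H))
    where
    killed = cong₂ _,_ (≔-same q _ false) (≔-keep q false free b⊥)

  both-by : ∀ q {s t x} → q ⌜ pair s t ⌝ ≡ just x → q ⌜ pair (not s) t ⌝ ≡ just x →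
            pairAt q t ≡ (just x , just x)
  both-by q {true}  own other = cong₂ _,_ own other
  both-by q {false} own other = cong₂ _,_ other own

  win-◁ : ∀ {F q t₀ s} → #free q ≤ F → SplitBefore q t₀ → q ⌜ pair s t₀ ⌝ ≡ just true →
          Free q ⌜ pair (not s) t₀ ⌝ → ∀ H → H ◁ eval S F q
  win-◁ {q = q} {s = s} fuel before own free H with fuel-move q true fuel free
  ... | f , refl , fuel′ =
    ◁-left (eval-lefts⁺ f q free)
      (≤G-trans (≤G-atom-greatest top-greatest H)
                (atom-≤G-eval f _ fuel′ (top-forced (splitBefore-≔ q true free before) won)))
    where
    won = both-by (q [ _ ≔ true ]) {s} (≔-keep q true free own) (≔-same q _ true)

  pair-partner : ∀ {s t} → pair s t ≢ pair (not s) t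
  pair-partner {true}  ()
  pair-partner {false} ()

  answer : Position N → Bool → Fin k → Position N
  answer q s t = q [ ⌜ pair s t ⌝ ≔ true ] [ ⌜ pair (not s) t ⌝ ≔ false ]

  answer-elsewhere : ∀ q s t c → (∀ s′ → pair s′ t ≢ c) → answer q s t ⌜ c ⌝ ≡ q ⌜ c ⌝
  answer-elsewhere q s t c outside =
    trans (≔-elsewhere (q [ ⌜ pair s t ⌝ ≔ true ]) (pair (not s) t) false c (outside (not s) ∘ sym))
          (≔-elsewhere q (pair s t) true c (outside s ∘ sym))

  answer-pairs : ∀ (Pr : Fin k → State → Set) q s t → (∀ t′ → t′ ≢ t → Pr t′ (pairAt q t′)) → Pr t (split s) →
                 ∀ t′ → Pr t′ (pairAt (answer q s t) t′)
  answer-pairs Pr q s t others at-t =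
    pairs-≔ Pr q₁ (not s) t false
      (λ t′ t′≢t → pairAt-≔-elsewhere (Pr t′) q (pair s t) true t′ (λ _ → pair-other t′≢t) (others t′ t′≢t))
      (subst (Pr t) (sym (split-by (answer q s t) {s} own other)) at-t)
    where
    q₁ = q [ ⌜ pair s t ⌝ ≔ true ]
    own = trans (≔-elsewhere q₁ _ false _ (pair-partner {s})) (≔-same q _ true)
    other = ≔-same q₁ ⌜ pair (not s) t ⌝ false

  -- Right's invariant once the gate is ⊥: no pair can reach (⊤,⊤), so the value stays ⊥.
  Safe : Position N → Set
  Safe q = q ⌜ gate ⌝ ≡ just false × ∀ t → Guarded (pairAt q t)

  ≔false-⊤⁻ : ∀ (q : Position N) {l i} → (q [ l ≔ false ]) i ≡ just true → q i ≡ just true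
  ≔false-⊤⁻ q {l} {i} eq with i Fin.≟ l
  ... | no _ = eq

  fromMaybe-⊤⁻ : ∀ {x} → fromMaybe false x ≡ true → x ≡ just true
  fromMaybe-⊤⁻ {just true} _ = refl

  guarded-partner : ∀ q {s t} → Guarded (pairAt q t) →
                    q ⌜ pair (not s) t ⌝ ≡ just true → q ⌜ pair s t ⌝ ≡ just false
  guarded-partner q {true}  (_ , b→a) = b→a
  guarded-partner q {false} (a→b , _) = a→b

  safe-value : ∀ {q} → Safe q → φ (colour S q) ≤A bot
  safe-value {q} (gate⊥ , guarded) with verdict (colour S q) in eq
  ... | decided true  = contradiction eq (scan-not-true _ _ no-double)
    where
    no-double : ∀ t → bits true (colour S q) t ≡ true → bits false (colour S q) t ≢ true
    no-double t a⊤ b⊤ with () ← trans (sym b⊤) (cong (fromMaybe false) (proj₁ (guarded t) (fromMaybe-⊤⁻ a⊤)))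
  ... | decided false = ≤A-refl
  ... | undecided rewrite gate⊥ = ≤A-refl

  safe-≔false : ∀ {q l} → Safe q → Free q l → Safe (q [ l ≔ false ])
  safe-≔false {q} {l} (gate⊥ , guarded) free = ≔-keep q false free gate⊥ , λ t →
    ≔-keep q false free ∘ proj₁ (guarded t) ∘ ≔false-⊤⁻ q {l} ,
    ≔-keep q false free ∘ proj₂ (guarded t) ∘ ≔false-⊤⁻ q {l}

  safe-reply : ∀ {q l} → Safe q → Free q l →
               Safe (q [ l ≔ true ]) ⊎
               ∃ λ l′ → Free (q [ l ≔ true ]) l′ × Safe (q [ l ≔ true ] [ l′ ≔ false ])
  safe-reply {q} {l} (gate⊥ , guarded) free with cell-view l
  ... | sub j , refl =
    inj₁ (trans (≔-elsewhere q (sub j) true gate λ ()) gate⊥ ,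
          λ t → pairAt-≔-elsewhere Guarded q (sub j) true t (λ _ ()) (guarded t))
  ... | gate , refl with () ← trans (sym free) gate⊥
  ... | pair s t , refl with q ⌜ pair (not s) t ⌝ in partner
  ...   | just true with () ← trans (sym free) (guarded-partner q {s} (guarded t) partner)
  ...   | just false =
    inj₁ (trans (≔-elsewhere q (pair s t) true gate λ ()) gate⊥ ,
          pairs-≔ (λ _ → Guarded) q s t true (λ t′ _ → guarded t′)
            (subst Guarded (sym (split-by q₁ {s} (≔-same q _ true) (≔-keep q true free partner)))
                   (split-guarded s)))
    where q₁ = q [ ⌜ pair s t ⌝ ≔ true ]
  ...   | nothing =
    inj₂ (⌜ pair (not s) t ⌝ , trans (≔-elsewhere q (pair s t) true _ (pair-partner ∘ sym)) partner ,
          trans (answer-elsewhere q s t gate λ _ ()) gate⊥ ,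
          answer-pairs (λ _ → Guarded) q s t (λ t′ _ → guarded t′) (split-guarded s))

  safe-≤G-atom : ∀ {F q} → Safe q → #free q ≤ F → eval S F q ≤G atom bot
  safe-≤G-atom {F} {q} safe fuel =
    RightKeeps.eval-≤G-atom Safe (λ {q} → safe-value {q}) (λ {q} → safe-≔false {q}) (λ {q} → safe-reply {q})
      F q fuel safe

  settled-guarded : ∀ {st} → Settled st → Guarded st
  settled-guarded (inj₁ refl)       = (λ ()) , λ ()
  settled-guarded (inj₂ (b , refl)) = split-guarded b

  open-free : ∀ q {t} s → pairAt q t ≡ (nothing , nothing) → Free q ⌜ pair s t ⌝
  open-free q true  eq = cong proj₁ eq
  open-free q false eq = cong proj₂ eq

  settled-open : ∀ q {s t} → Settled (pairAt q t) → Free q ⌜ pair s t ⌝ → pairAt q t ≡ (nothing , nothing)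
  settled-open q             (inj₁ unplayed)     _    = unplayed
  settled-open q {true}  {t} (inj₂ (b , eq)) free with () ← trans (sym free) (cong proj₁ eq)
  settled-open q {false} {t} (inj₂ (b , eq)) free with () ← trans (sym free) (cong proj₂ eq)

  ≔-subFree : ∀ q c b → (∀ j → sub j ≢ c) → SubFree q → SubFree (q [ ⌜ c ⌝ ≔ b ])
  ≔-subFree q c b outside sub-free j = trans (≔-elsewhere q c b (sub j) (outside j)) (sub-free j)

  -- Positions reached by Right's strategy, before (g = nothing) and after (g = just true) Left
  -- opens the gate.
  Calm : Maybe Bool → Position N → Set
  Calm g q = q ⌜ gate ⌝ ≡ g × SubFree q × ∀ t → Settled (pairAt q t)

  -- Right has just put ⊥ into the first open pair: Left must answer with ⊤ beside it or lose.
  Challenged : Fin k → Position N → Set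
  Challenged t₀ q = q ⌜ gate ⌝ ≡ just true × SubFree q × (∀ t → t ≢ t₀ → Settled (pairAt q t)) ×
                    SplitBefore q t₀ × Free q ⌜ pair true t₀ ⌝ × q ⌜ pair false t₀ ⌝ ≡ just false

  close-◁ : ∀ {F q} → #free q ≤ F → Free q ⌜ gate ⌝ → (∀ t → Guarded (pairAt q t)) → ∀ H → eval S F q ◁ H
  close-◁ {q = q} fuel free guarded H with fuel-move q false fuel free
  ... | f , refl , fuel′ =
    ◁-right (eval-rights⁺ f q free) (≤G-trans (safe-≤G-atom safe fuel′) (atom-least-≤G bot-least H))
    where
    safe = ≔-same q _ false , λ t → pairAt-≔-elsewhere Guarded q gate false t (λ _ ()) (guarded t)

  mutual
    entered-◁ : ∀ {F q} → Calm (just true) q → #free q ≤ F → eval S F q ◁ choice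
    entered-◁ {F} {q} (gate⊤ , sub-free , settled) fuel with all-or-least settled
    ... | inj₁ splits = ◁-left (G∈lefts-choice _) (leaf-≤G (gate⊤ , sub-free , proj₂ ∘ splits) fuel)
    ... | inj₂ (t₀ , unplayed , before) with fuel-move q false fuel (open-free q false unplayed)
    ...   | f , refl , fuel′ =
      ◁-right (eval-rights⁺ f q (open-free q false unplayed)) (challenged-≤G challenged fuel′)
      where
      challenged : Challenged t₀ (q [ ⌜ pair false t₀ ⌝ ≔ false ])
      challenged =
        trans (≔-elsewhere q (pair false t₀) false gate λ ()) gate⊤ ,
        ≔-subFree q (pair false t₀) false (λ _ ()) sub-free ,
        (λ t t≢t₀ → pairAt-≔-elsewhere Settled q (pair false t₀) false t (λ _ → pair-other t≢t₀)
                                       (settled t)) ,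
        splitBefore-≔ q false (open-free q false unplayed) before ,
        trans (≔-elsewhere q (pair false t₀) false (pair true t₀) λ ()) (open-free q true unplayed) ,
        ≔-same q _ false

    challenged-≤G : ∀ {F q t₀} → Challenged t₀ q → #free q ≤ F → eval S F q ≤G choice
    challenged-≤G {F} {q} {t₀} (gate⊤ , sub-free , settled , before , a-free , b⊥) fuel =
      ≤G-intro left (λ _ → kill-◁ fuel before a-free b⊥ _) (λ _ → kill-◁ fuel before a-free b⊥ choice)
      where
      left : ∀ {GL} → GL ∈ lefts (eval S F q) → GL ◁ choice
      left GL∈ with eval-lefts⁻ {F} {q} GL∈
      ... | f , l , refl , free , refl with l Fin.≟ ⌜ pair true t₀ ⌝
      ...   | yes refl = entered-◁ accepted (fuel-≔ q true fuel free)
        where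
        accepted : Calm (just true) (q [ ⌜ pair true t₀ ⌝ ≔ true ])
        accepted =
          trans (≔-elsewhere q (pair true t₀) true gate λ ()) gate⊤ ,
          ≔-subFree q (pair true t₀) true (λ _ ()) sub-free ,
          pairs-≔ (λ _ → Settled) q true t₀ true settled
            (inj₂ (true , split-by (q [ l ≔ true ]) {true} (≔-same q l true) (≔-keep q true free b⊥)))
      ...   | no l≢a =
        kill-◁ (fuel-≔ q true fuel free) (splitBefore-≔ q true free before)
               (trans (≔-other q true (l≢a ∘ sym)) a-free) (≔-keep q true free b⊥) choice

  ready-≤G : ∀ {F q} → Calm nothing q → #free q ≤ F → eval S F q ≤G choice
  ready-≤G {F} {q} (gate⋆ , sub-free , settled) fuel =
    ≤G-intro left (λ _ → close-◁ fuel gate⋆ guarded _) (λ _ → close-◁ fuel gate⋆ guarded choice)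
    where
    guarded : ∀ t → Guarded (pairAt q t)
    guarded = settled-guarded ∘ settled
    partner-free : ∀ s t → Free q ⌜ pair s t ⌝ → Free (q [ ⌜ pair s t ⌝ ≔ true ]) ⌜ pair (not s) t ⌝
    partner-free s t free = trans (≔-elsewhere q (pair s t) true _ (pair-partner {s} ∘ sym))
                                  (open-free q (not s) (settled-open q {s} (settled t) free))
    left : ∀ {GL} → GL ∈ lefts (eval S F q) → GL ◁ choice
    left GL∈ with eval-lefts⁻ {F} {q} GL∈
    ... | f , l , refl , free , refl with cell-view l
    ...   | sub j , refl =
      close-◁ (fuel-≔ q true fuel free) (trans (≔-elsewhere q (sub j) true gate λ ()) gate⋆)
              (λ t → pairAt-≔-elsewhere Guarded q (sub j) true t (λ _ ()) (guarded t)) choice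
    ...   | gate , refl =
      entered-◁ (≔-same q _ true , ≔-subFree q gate true (λ _ ()) sub-free ,
                 λ t → pairAt-≔-elsewhere Settled q gate true t (λ _ ()) (settled t))
                (fuel-≔ q true fuel free)
    ...   | pair s t , refl
      with fuel-move (q [ l ≔ true ]) false (fuel-≔ q true fuel free) (partner-free s t free)
    ...     | f′ , refl , fuel′ =
      ◁-right (eval-rights⁺ f′ _ (partner-free s t free))
        (ready-≤G (trans (answer-elsewhere q s t gate λ _ ()) gate⋆ ,
                   (λ j → trans (answer-elsewhere q s t (sub j) λ _ ()) (sub-free j)) ,
                   answer-pairs (λ _ → Settled) q s t (λ t′ _ → settled t′) (inj₂ (s , refl)))
                  fuel′)

  -- Positions reached by Left's strategy for moving to G (select β).
  Toward : Bool → State → Set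
  Toward b st = st ≡ (nothing , nothing) ⊎ st ≡ split b

  Aiming : (Fin k → Bool) → Position N → Set
  Aiming β q = Free q ⌜ gate ⌝ × SubFree q × ∀ t → Toward (β t) (pairAt q t)

  -- Left has just claimed cell β t₀ of the first open pair: Right must answer beside it or lose.
  Committed : (Fin k → Bool) → Fin k → Position N → Set
  Committed β t₀ q = Free q ⌜ gate ⌝ × SubFree q × (∀ t → t ≢ t₀ → Toward (β t) (pairAt q t)) ×
                     (∀ t → t Fin.< t₀ → pairAt q t ≡ split (β t)) ×
                     q ⌜ pair (β t₀) t₀ ⌝ ≡ just true × Free q ⌜ pair (not (β t₀)) t₀ ⌝

  mutual
    aiming-◁ : ∀ {β F q} → Aiming β q → #free q ≤ F → G (select β) ◁ eval S F q
    aiming-◁ {β} {F} {q} (gate⋆ , sub-free , toward) fuel with all-or-least toward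
    ... | inj₁ splits with fuel-move q true fuel gate⋆
    ...   | f , refl , fuel′ =
      ◁-left (eval-lefts⁺ f q gate⋆)
        (≤G-leaf (≔-same q _ true , ≔-subFree q gate true (λ _ ()) sub-free ,
                  λ t → pairAt-≔-keep q true gate⋆ (splits t)) fuel′)
    aiming-◁ {β} {F} {q} (gate⋆ , sub-free , toward) fuel | inj₂ (t₀ , unplayed , before)
      with fuel-move q true fuel (open-free q (β t₀) unplayed)
    ... | f , refl , fuel′ =
      ◁-left (eval-lefts⁺ f q (open-free q (β t₀) unplayed)) (committed-≤G committed fuel′)
      where
      committed : Committed β t₀ (q [ ⌜ pair (β t₀) t₀ ⌝ ≔ true ])
      committed =
        trans (≔-elsewhere q (pair (β t₀) t₀) true gate λ ()) gate⋆ ,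
        ≔-subFree q (pair (β t₀) t₀) true (λ _ ()) sub-free ,
        (λ t t≢t₀ → pairAt-≔-elsewhere (Toward (β t)) q (pair (β t₀) t₀) true t (λ _ → pair-other t≢t₀)
                                       (toward t)) ,
        (λ t t<t₀ → pairAt-≔-keep q true (open-free q (β t₀) unplayed) (before t t<t₀)) ,
        ≔-same q _ true ,
        trans (≔-elsewhere q (pair (β t₀) t₀) true _ (pair-partner {β t₀} ∘ sym))
              (open-free q (not (β t₀)) unplayed)

    committed-≤G : ∀ {β t₀ F q} → Committed β t₀ q → #free q ≤ F → G (select β) ≤G eval S F q
    committed-≤G {β} {t₀} {F} {q} (gate⋆ , sub-free , toward , before , own , partner) fuel =
      ≤G-intro (λ _ → win _) right (λ _ → win _)
      where
      split-before : SplitBefore q t₀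
      split-before t t<t₀ = β t , before t t<t₀
      win : ∀ H → H ◁ eval S F q
      win = win-◁ {s = β t₀} fuel split-before own partner
      right : ∀ {GR} → GR ∈ rights (eval S F q) → G (select β) ◁ GR
      right GR∈ with eval-rights⁻ {F} {q} GR∈
      ... | f , l , refl , free , refl with l Fin.≟ ⌜ pair (not (β t₀)) t₀ ⌝
      ...   | yes refl = aiming-◁ aiming (fuel-≔ q false fuel free)
        where
        aiming : Aiming β (q [ l ≔ false ])
        aiming =
          trans (≔-elsewhere q (pair (not (β t₀)) t₀) false gate λ ()) gate⋆ ,
          ≔-subFree q (pair (not (β t₀)) t₀) false (λ _ ()) sub-free ,
          pairs-≔ (Toward ∘ β) q (not (β t₀)) t₀ false toward
            (inj₂ (split-by (q [ l ≔ false ]) {β t₀} (≔-keep q false free own) (≔-same q l false)))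
      ...   | no l≢partner =
        win-◁ {s = β t₀} (fuel-≔ q false fuel free) (splitBefore-≔ q false free split-before)
              (≔-keep q false free own) (trans (≔-other q false (l≢partner ∘ sym)) partner) _

  choice-≤G : choice ≤G ⟦ S ⟧
  choice-≤G = ≤G-intro left (λ _ → ◁-right (here refl) (atom-least-≤G bot-least _))
                         (λ _ → ◁-right (here refl) (atom-least-≤G bot-least _))
    where
    left : ∀ {GL} → GL ∈ lefts choice → GL ◁ ⟦ S ⟧
    left GL∈ with lefts-choice⁻ GL∈
    ... | i , refl with select-surjective n≤2^k i
    ...   | β , selects-i =
      subst (_◁ ⟦ S ⟧) (cong G selects-i)
        (aiming-◁ {β} {N} {λ _ → nothing} (refl , (λ _ → refl) , λ _ → inj₁ refl) (#free-≤ _))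

  ≤G-choice : ⟦ S ⟧ ≤G choice
  ≤G-choice = ready-≤G {N} {λ _ → nothing} (refl , (λ _ → refl) , λ _ → inj₁ refl) (#free-≤ _)

  choice-realizable : Realizable choice N
  choice-realizable = S , choice-≤G , ≤G-choice

n≤2^⌈log2⌉n : ∀ n (rec : Acc _<_ n) → n ≤ 2 ^ ⌈log2⌉ n rec
n≤2^⌈log2⌉n 0             _         = z≤n
n≤2^⌈log2⌉n 1             _         = ℕ.≤-refl
n≤2^⌈log2⌉n (suc (suc n)) (acc rec) = begin
  2 + n                  ≤⟨ s≤s (s≤s n≤2⌈n/2⌉) ⟩
  2 + 2 * ⌈ n /2⌉        ≡⟨ ℕ.*-suc 2 ⌈ n /2⌉ ⟨
  2 * suc ⌈ n /2⌉        ≤⟨ ℕ.*-monoʳ-≤ 2 (n≤2^⌈log2⌉n (suc ⌈ n /2⌉) (rec (ℕ.⌈n/2⌉<n n))) ⟩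
  2 * 2 ^ ⌈log2⌉ (suc ⌈ n /2⌉) (rec (ℕ.⌈n/2⌉<n n))     ∎
  where
  open ℕ.≤-Reasoning
  n≤2⌈n/2⌉ : n ≤ 2 * ⌈ n /2⌉
  n≤2⌈n/2⌉ = begin
    n                      ≡⟨ ℕ.⌊n/2⌋+⌈n/2⌉≡n n ⟨
    ⌊ n /2⌋ + ⌈ n /2⌉       ≤⟨ ℕ.+-monoˡ-≤ ⌈ n /2⌉ (ℕ.⌊n/2⌋≤⌈n/2⌉ n) ⟩
    ⌈ n /2⌉ + ⌈ n /2⌉       ≡⟨ cong (⌈ n /2⌉ +_) (ℕ.+-identityʳ _) ⟨
    2 * ⌈ n /2⌉             ∎

n≤2^⌈log₂n⌉ : ∀ n → n ≤ 2 ^ ⌈log₂ n ⌉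
n≤2^⌈log₂n⌉ n = n≤2^⌈log2⌉n n (<-wellFounded n)

≤maxFin : ∀ n (f : Fin n → ℕ) i → f i ≤ maxFin n f
≤maxFin (suc n) f Fin.zero    = ℕ.m≤m⊔n _ _
≤maxFin (suc n) f (Fin.suc i) = ℕ.m≤n⇒m≤o⊔n (f Fin.zero) (≤maxFin n (f ∘ Fin.suc) i)

proposition4p2 : ∀ {c ℓ₁ ℓ₂} (P : Poset c ℓ₁ ℓ₂) →
    let open GameOrder P in
    (top bot : Poset.Carrier P) →
    (∀ x → Poset._≤_ P x top) → (∀ x → Poset._≤_ P bot x) →
    (n : ℕ) .{{_ : NonZero n}} →
    (G : Fin n → Game (Poset.Carrier P)) (p : Fin n → ℕ) →
    (∀ i → Realizable (G i) (p i)) →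
    Realizable (node (fromFin⁺ n G) [ atom bot ]) (maxFin n p + 2 * ⌈log₂ n ⌉ + 1)
proposition4p2 P top bot top-greatest bot-least (suc n₀) G p realized =
  Construction.choice-realizable P top bot top-greatest bot-least G p realized
    (maxFin (suc n₀) p) ⌈log₂ suc n₀ ⌉ (≤maxFin (suc n₀) p) (n≤2^⌈log₂n⌉ (suc n₀))
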